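{- Let $k\geq 2$ be an integer, let $H$ be a graph and $\mathcal{C}_H$ a collection of pairwise disjoint non-empty subsets of $V(H)$ such that for each $D\in\mathcal{C}_H$ we have $\overline{e}_H(D)\leq (k-1)|D|+1$ and $\deg_H(v)\geq k$ for all $v\in D$. Then for every $w\in V_{\leq k-1}(H)$ we have $\overline{e}_H(\operatorname{sh}_H(w))\leq (k-1)|\operatorname{sh}_H(w)|$.
   Context: Graphs are finite and simple. $V_{\leq k-1}(H)$ is the set of vertices of $H$ of degree at most $k-1$. For $X\subseteq V(H)$, $\overline{e}_H(X)$ is the number of edges of $H$ incident with at least one vertex of $X$, and $H-X$ is the graph obtained by deleting $X$. A vertex $v$ is adjacent to a set $X$ if it is adjacent to some vertex of $X$. For $w\in V_{\leq k-1}(H)$, the shadow $\operatorname{sh}_H(w)$ (with respect to $\mathcal{C}_H$) is the unique minimal (under inclusion) set $Y\subseteq V(H)$ such that: (I) $w\in Y$; (II) for each $D\in\mathcal{C}_H$, either $D\subseteq Y$ or $D\cap Y=\emptyset$; (III) if $v\in V(H)\setminus Y$ is adjacent to a vertex in $Y$, then $\deg_{H-Y}(v)\geq k$; (IV) if $D\in\mathcal{C}_H$ is adjacent to a vertex in $Y$, then $D\subseteq Y$. (Such a minimal set exists and is unique since $V(H)$ has these properties and they are preserved under intersection.) -}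

module Defs where

open import Data.Nat using (ℕ; zero; suc; _+_; _<ᵇ_)
open import Data.Bool using (Bool; true; false; _∧_; _∨_; if_then_else_; not)
open import Data.Fin using (Fin; zero; suc; toℕ)
open import Data.Fin.Subset using (Subset; _∈_; _∉_; _⊆_; ∣_∣; Nonempty)
open import Data.Vec using (lookup)
open import Data.Product using (Σ; _×_; ∃; ∃-syntax)
open import Data.Sum using (_⊎_)
open import Data.Empty using (⊥)
open import Relation.Nullary using (¬_)
open import Relation.Binary.PropositionalEquality using (_≡_)

record Graph (n : ℕ) : Set where
  field
    adj       : Fin n → Fin n → Bool
    adj-sym   : ∀ u v → adj u v ≡ adj v u
    adj-irrefl : ∀ v → adj v v ≡ false
open Graph public

Adj : ∀ {n} → Graph n → Fin n → Fin n → Set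
Adj H u v = adj H u v ≡ true

count : ∀ n → (Fin n → Bool) → ℕ
count zero    p = 0
count (suc n) p = (if p zero then 1 else 0) + count n (λ i → p (suc i))

sumF : ∀ n → (Fin n → ℕ) → ℕ
sumF zero    f = 0
sumF (suc n) f = f zero + sumF n (λ i → f (suc i))

deg : ∀ {n} → Graph n → Fin n → ℕ
deg {n} H v = count n (λ u → adj H v u)

-- degree of v in H - Y (neighbours of v outside Y); meaningful for v ∉ Y
degMinus : ∀ {n} → Graph n → Subset n → Fin n → ℕ
degMinus {n} H Y v = count n (λ u → adj H v u ∧ not (lookup Y u))

-- ē_H(X): number of edges of H incident with at least one vertex of X
-- (each edge {u,v} counted once, via toℕ u < toℕ v)
ebar : ∀ {n} → Graph n → Subset n → ℕ
ebar {n} H X =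
  sumF n (λ u → count n (λ v →
    (toℕ u <ᵇ toℕ v) ∧ adj H u v ∧ (lookup X u ∨ lookup X v)))

Disjoint : ∀ {n} → Subset n → Subset n → Set
Disjoint A B = ∀ x → x ∈ A → x ∉ B

AdjToSet : ∀ {n} → Graph n → Fin n → Subset n → Set
AdjToSet H v X = ∃[ x ] (x ∈ X × Adj H v x)

-- The properties (I)-(IV) of a set Y relative to w and the collection
-- C : Fin m → Subset n
ShadowProps : ∀ {n m} → ℕ → Graph n → (Fin m → Subset n) → Fin n → Subset n → Set
ShadowProps k H C w Y =
    (w ∈ Y)
  × (∀ i → (C i ⊆ Y) ⊎ Disjoint (C i) Y)
  × (∀ v → v ∉ Y → AdjToSet H v Y → k Data.Nat.≤ degMinus H Y v)
  × (∀ i → (∃[ d ] (d ∈ C i × AdjToSet H d Y)) → C i ⊆ Y)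

IsShadow : ∀ {n m} → ℕ → Graph n → (Fin m → Subset n) → Fin n → Subset n → Set
IsShadow {n} k H C w Y =
  ShadowProps k H C w Y × (∀ (Z : Subset n) → ShadowProps k H C w Z → Y ⊆ Z)

module Submission where

-- Write K = k ∸ 1 and call Z ⊆ V(H) sparse when ē(Z) ≤ K·|Z|.  The shadow Y
-- of w is the least set with (I)–(IV); we reach it from below.  The set {w}
-- is sparse (ē({w}) ≤ deg w ≤ K) and meets no cluster D ∈ 𝒞 (vertices of D
-- have degree ≥ k > deg w).  A sparse, cluster-respecting Z ⊆ Y containing w
-- that fails (III) or (IV) can be enlarged inside Y keeping these properties:
--  * (IV) fails at D adjacent to Z: D ⊆ Y by (IV) for Y, and the edge joining
--    D to Z is counted in both ē(Z) and ē(D), so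
--    ē(Z ∪ D) ≤ ē(Z) + ē(D) − 1 ≤ K|Z| + K|D| = K|Z ∪ D|;
--  * (III) fails at v with deg_{H−Z}(v) ≤ K (v in no cluster, else (IV)
--    fails): v ∈ Y by (III) for Y, and adjoining v adds at most
--    deg_{H−Z}(v) ≤ K edges.
-- Sizes are bounded by n, so this stops at some Z ⊆ Y with (I)–(IV), and
-- minimality of Y gives Z = Y.

open import Defs
open import Data.Bool using (Bool; true; false; _∧_; _∨_; not; if_then_else_)
open import Data.Bool.Properties using (∧-identityʳ; ∧-zeroʳ; ∨-zeroʳ; ¬-not; T-≡) renaming (_≟_ to _≟ᵇ_)
open import Data.Empty using (⊥-elim)
open import Data.Fin using (Fin; zero; suc; toℕ)
open import Data.Fin.Properties using (_≟_; any?; suc-injective; toℕ-injective)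
open import Data.Fin.Subset using (Subset; _∪_; _∈_; _∉_; _⊆_; ∣_∣; ⁅_⁆; Nonempty; inside; outside) renaming (⊥ to ∅)
open import Data.Fin.Subset.Properties using (_∈?_; _⊆?_; x∈p∪q⁻; p⊆p∪q; q⊆p∪q; x∈⁅x⁆; x∈⁅y⁆⇒x≡y; ∣⁅x⁆∣≡1; ⊆-antisym; p⊆q⇒∣p∣≤∣q∣; ∣p∣≤n; ∪-identityˡ)
open import Data.Nat using (ℕ; zero; suc; _≤_; _<_; _+_; _*_; _∸_; z≤n; s≤s; _<ᵇ_; _≤?_; _<?_)
open import Data.Nat.Properties hiding (suc-injective; _≟_)
open import Algebra.Properties.CommutativeSemigroup +-commutativeSemigroup using (interchange)
open import Data.Product using (_×_; _,_; proj₁; proj₂; ∃; ∃-syntax)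
open import Data.Sum using (_⊎_; inj₁; inj₂; [_,_])
open import Data.Vec using (lookup; _∷_; []; here; there)
open import Data.Vec.Properties using (lookup-zipWith; lookup-replicate; []=⇒lookup; lookup⇒[]=)
open import Function using (_∘_; id)
open import Function.Bundles using (Equivalence)
open import Relation.Binary using (tri<; tri≈; tri>)
open import Relation.Binary.PropositionalEquality using (_≡_; _≢_; refl; sym; trans; cong; cong₂; subst; subst₂)
open import Relation.Nullary using (¬_; Dec; yes; no)
open import Relation.Nullary.Decidable using (_×-dec_; ¬?; decidable-stable)

ind : Bool → ℕ
ind b = if b then 1 else 0

ind≤1 : ∀ b → ind b ≤ 1
ind≤1 true  = ≤-refl
ind≤1 false = z≤n

ind-mono : ∀ {a b} → (a ≡ true → b ≡ true) → ind a ≤ ind b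
ind-mono {false} a⇒b = z≤n
ind-mono {true}  a⇒b rewrite a⇒b refl = ≤-refl

count≡sumF : ∀ n (p : Fin n → Bool) → count n p ≡ sumF n (λ i → ind (p i))
count≡sumF zero    p = refl
count≡sumF (suc n) p = cong (ind (p zero) +_) (count≡sumF n (λ i → p (suc i)))

sumF-cong : ∀ n {f g : Fin n → ℕ} → (∀ i → f i ≡ g i) → sumF n f ≡ sumF n g
sumF-cong zero    f≡g = refl
sumF-cong (suc n) f≡g = cong₂ _+_ (f≡g zero) (sumF-cong n (λ i → f≡g (suc i)))

sumF-mono : ∀ n {f g : Fin n → ℕ} → (∀ i → f i ≤ g i) → sumF n f ≤ sumF n g
sumF-mono zero    f≤g = z≤n
sumF-mono (suc n) f≤g = +-mono-≤ (f≤g zero) (sumF-mono n (λ i → f≤g (suc i)))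

sumF-mono-< : ∀ n {f g : Fin n → ℕ} → (∀ i → f i ≤ g i) → ∀ j → f j < g j → sumF n f < sumF n g
sumF-mono-< (suc n) f≤g zero    fj<gj = +-mono-<-≤ fj<gj (sumF-mono n (λ i → f≤g (suc i)))
sumF-mono-< (suc n) f≤g (suc j) fj<gj = +-mono-≤-< (f≤g zero) (sumF-mono-< n (λ i → f≤g (suc i)) j fj<gj)

sumF-+ : ∀ n (f g : Fin n → ℕ) → sumF n (λ i → f i + g i) ≡ sumF n f + sumF n g
sumF-+ zero    f g = refl
sumF-+ (suc n) f g =
  trans (cong (f zero + g zero +_) (sumF-+ n (λ i → f (suc i)) (λ i → g (suc i))))
        (interchange (f zero) (g zero) _ _)

sumF-zero : ∀ n {f : Fin n → ℕ} → (∀ i → f i ≡ 0) → sumF n f ≡ 0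
sumF-zero zero    f≡0 = refl
sumF-zero (suc n) f≡0 = cong₂ _+_ (f≡0 zero) (sumF-zero n (λ i → f≡0 (suc i)))

sumF-supported : ∀ n {f : Fin n → ℕ} v → (∀ i → i ≢ v → f i ≡ 0) → sumF n f ≡ f v
sumF-supported (suc n) {f} zero    off =
  trans (cong (f zero +_) (sumF-zero n (λ i → off (suc i) λ ()))) (+-identityʳ (f zero))
sumF-supported (suc n) {f} (suc v) off =
  cong₂ _+_ (off zero λ ()) (sumF-supported n v (λ i i≢v → off (suc i) (i≢v ∘ suc-injective)))

sum2 : ∀ n → (Fin n → Fin n → ℕ) → ℕ
sum2 n F = sumF n (λ u → sumF n (F u))

sum2-mono : ∀ n {F G : Fin n → Fin n → ℕ} → (∀ u v → F u v ≤ G u v) → sum2 n F ≤ sum2 n G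
sum2-mono n F≤G = sumF-mono n (λ u → sumF-mono n (F≤G u))

sum2-mono-< : ∀ n {F G : Fin n → Fin n → ℕ} → (∀ u v → F u v ≤ G u v)
  → ∀ p q → F p q < G p q → sum2 n F < sum2 n G
sum2-mono-< n F≤G p q Fpq<Gpq =
  sumF-mono-< n (λ u → sumF-mono n (F≤G u)) p (sumF-mono-< n (F≤G p) q Fpq<Gpq)

sum2-+ : ∀ n (F G : Fin n → Fin n → ℕ) → sum2 n (λ u v → F u v + G u v) ≡ sum2 n F + sum2 n G
sum2-+ n F G = trans (sumF-cong n (λ u → sumF-+ n (F u) (G u))) (sumF-+ n _ _)

∈⇒lookup : ∀ {n} {x : Fin n} {p : Subset n} → x ∈ p → lookup p x ≡ true
∈⇒lookup = []=⇒lookup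

lookup⇒∈ : ∀ {n} {x : Fin n} {p : Subset n} → lookup p x ≡ true → x ∈ p
lookup⇒∈ {x = x} {p} = lookup⇒[]= x p

lookup-∪ : ∀ {n} (p q : Subset n) u → lookup (p ∪ q) u ≡ (lookup p u ∨ lookup q u)
lookup-∪ p q u = lookup-zipWith _∨_ u p q

lookup-∅ : ∀ {n} (u : Fin n) → lookup ∅ u ≡ false
lookup-∅ u = lookup-replicate u outside

lookup-⁅⁆-at : ∀ {n} (v : Fin n) → lookup ⁅ v ⁆ v ≡ true
lookup-⁅⁆-at v = ∈⇒lookup (x∈⁅x⁆ v)

lookup-⁅⁆-off : ∀ {n} {u v : Fin n} → u ≢ v → lookup ⁅ v ⁆ u ≡ false
lookup-⁅⁆-off {v = v} u≢v = ¬-not (λ u∈v → u≢v (x∈⁅y⁆⇒x≡y v (lookup⇒∈ u∈v)))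

sumF-⁅⁆ : ∀ {n} v (g : Fin n → Bool) → sumF n (λ u → ind (lookup ⁅ v ⁆ u ∧ g u)) ≡ ind (g v)
sumF-⁅⁆ {n} v g =
  trans (sumF-supported n v (λ u u≢v → cong (λ b → ind (b ∧ g u)) (lookup-⁅⁆-off u≢v)))
        (cong (λ b → ind (b ∧ g v)) (lookup-⁅⁆-at v))

sum2-⁅⁆ : ∀ {n} v (R : Fin n → Fin n → Bool)
  → sum2 n (λ u u' → ind (lookup ⁅ v ⁆ u ∧ R u u')) ≡ sumF n (λ u' → ind (R v u'))
sum2-⁅⁆ {n} v R =
  trans (sumF-supported n v (λ u u≢v →
           sumF-zero n (λ u' → cong (λ b → ind (b ∧ R u u')) (lookup-⁅⁆-off u≢v))))
        (sumF-cong n (λ u' → cong (λ b → ind (b ∧ R v u')) (lookup-⁅⁆-at v)))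

∪-⊆ : ∀ {n} {p q r : Subset n} → p ⊆ r → q ⊆ r → p ∪ q ⊆ r
∪-⊆ {p = p} {q} p⊆r q⊆r x∈p∪q = [ p⊆r , q⊆r ] (x∈p∪q⁻ p q x∈p∪q)

∣∪∣-disjoint : ∀ {n} (p q : Subset n) → Disjoint p q → ∣ p ∪ q ∣ ≡ ∣ p ∣ + ∣ q ∣
∣∪∣-disjoint []            []            p#q = refl
∣∪∣-disjoint (inside  ∷ p) (inside  ∷ q) p#q = ⊥-elim (p#q zero here here)
∣∪∣-disjoint (inside  ∷ p) (outside ∷ q) p#q = cong suc (∣∪∣-disjoint p q (λ x x∈p x∈q → p#q (suc x) (there x∈p) (there x∈q)))
∣∪∣-disjoint (outside ∷ p) (inside  ∷ q) p#q =
  trans (cong suc (∣∪∣-disjoint p q (λ x x∈p x∈q → p#q (suc x) (there x∈p) (there x∈q)))) (sym (+-suc ∣ p ∣ ∣ q ∣))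
∣∪∣-disjoint (outside ∷ p) (outside ∷ q) p#q = ∣∪∣-disjoint p q (λ x x∈p x∈q → p#q (suc x) (there x∈p) (there x∈q))

∈⇒1≤∣p∣ : ∀ {n} {x : Fin n} {p : Subset n} → x ∈ p → 1 ≤ ∣ p ∣
∈⇒1≤∣p∣ {x = x} {p} x∈p =
  subst (_≤ ∣ p ∣) (∣⁅x⁆∣≡1 x) (p⊆q⇒∣p∣≤∣q∣ (λ y∈x → subst (_∈ p) (sym (x∈⁅y⁆⇒x≡y x y∈x)) x∈p))

∣∪∣-grows : ∀ {n} (p q : Subset n) {x} → Disjoint p q → x ∈ q → ∣ p ∣ < ∣ p ∪ q ∣
∣∪∣-grows p q p#q x∈q =
  subst (∣ p ∣ <_) (sym (∣∪∣-disjoint p q p#q))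
        (≤-trans (≤-reflexive (+-comm 1 ∣ p ∣)) (+-monoʳ-≤ ∣ p ∣ (∈⇒1≤∣p∣ x∈q)))

*-∣∪∣ : ∀ {n} c (p q : Subset n) → Disjoint p q → c * ∣ p ∣ + c * ∣ q ∣ ≡ c * ∣ p ∪ q ∣
*-∣∪∣ c p q p#q = trans (sym (*-distribˡ-+ c ∣ p ∣ ∣ q ∣)) (cong (c *_) (sym (∣∪∣-disjoint p q p#q)))

-- Pointwise facts behind the edge counts; l ∧ a says that a listed pair of
-- vertices is an edge.  An edge meeting X ∪ D meets X, or meets D but not X.
ind-∪-split : ∀ l a xu xv du dv → ind (l ∧ a ∧ ((xu ∨ du) ∨ (xv ∨ dv)))
  ≤ ind (l ∧ a ∧ (xu ∨ xv)) + ind (l ∧ a ∧ (du ∨ dv) ∧ not (xu ∨ xv))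
ind-∪-split false a     xu    xv    du dv = z≤n
ind-∪-split true  false xu    xv    du dv = z≤n
ind-∪-split true  true  true  xv    du dv = s≤s z≤n
ind-∪-split true  true  false true  du dv = ≤-trans (ind≤1 (du ∨ true)) (s≤s z≤n)
ind-∪-split true  true  false false du dv = ≤-reflexive (cong ind (sym (∧-identityʳ (du ∨ dv))))

ind-gained≤ : ∀ l a d y → ind (l ∧ a ∧ d ∧ y) ≤ ind (l ∧ a ∧ d)
ind-gained≤ false a     d     y = z≤n
ind-gained≤ true  false d     y = z≤n
ind-gained≤ true  true  false y = z≤n
ind-gained≤ true  true  true  y = ind≤1 y

ind-gained<ind : ∀ l a d x → l ≡ true → a ≡ true → d ≡ true → x ≡ true
  → ind (l ∧ a ∧ d ∧ not x) < ind (l ∧ a ∧ d)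
ind-gained<ind .true .true .true .true refl refl refl refl = s≤s z≤n

ind-gained-⁅⁆ : ∀ l a p q x y
  → ind (l ∧ a ∧ (p ∨ q) ∧ not (x ∨ y)) ≤ ind (p ∧ l ∧ a ∧ not y) + ind (q ∧ l ∧ a ∧ not x)
ind-gained-⁅⁆ false a     p     q     x     y = z≤n
ind-gained-⁅⁆ true  false p     q     x     y = z≤n
ind-gained-⁅⁆ true  true  true  q     true  y = z≤n
ind-gained-⁅⁆ true  true  true  q     false y = m≤m+n (ind (not y)) _
ind-gained-⁅⁆ true  true  false true  true  y = z≤n
ind-gained-⁅⁆ true  true  false true  false y = ind≤1 (not y)
ind-gained-⁅⁆ true  true  false false x     y = z≤n

ind-exclusive : ∀ p q c → (p ≡ true → q ≡ false) → ind (p ∧ c) + ind (q ∧ c) ≤ ind c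
ind-exclusive true  q     c excl rewrite excl refl = ≤-reflexive (+-identityʳ (ind c))
ind-exclusive false true  c excl = ≤-refl
ind-exclusive false false c excl = z≤n

<ᵇ-exclusive : ∀ a b → (a <ᵇ b) ≡ true → (b <ᵇ a) ≡ false
<ᵇ-exclusive a b a<b = ¬-not (λ b<a →
  <-asym (<ᵇ⇒< a b (Equivalence.from T-≡ a<b)) (<ᵇ⇒< b a (Equivalence.from T-≡ b<a)))

∨-introˡ : ∀ {a} b → a ≡ true → (a ∨ b) ≡ true
∨-introˡ b a≡true = cong (_∨ b) a≡true

∨-introʳ : ∀ a {b} → b ≡ true → (a ∨ b) ≡ true
∨-introʳ a b≡true = trans (cong (a ∨_) b≡true) (∨-zeroʳ a)

∧-true-left : ∀ a {b} → (a ∧ b) ≡ true → a ≡ true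
∧-true-left true _ = refl

∧-not-antitone : ∀ a y z → (z ≡ true → y ≡ true) → (a ∧ not y) ≡ true → (a ∧ not z) ≡ true
∧-not-antitone true y false z⇒y _    = refl
∧-not-antitone true y true  z⇒y ¬y with trans (sym (cong not (z⇒y refl))) ¬y
... | ()

count-mono : ∀ n {p q : Fin n → Bool} → (∀ i → p i ≡ true → q i ≡ true) → count n p ≤ count n q
count-mono n p⇒q = subst₂ _≤_ (sym (count≡sumF n _)) (sym (count≡sumF n _)) (sumF-mono n (λ i → ind-mono (p⇒q i)))

module EdgeCounting {n : ℕ} (H : Graph n) where

  lt : Fin n → Fin n → Bool
  lt u v = toℕ u <ᵇ toℕ v

  meets : Subset n → Fin n → Fin n → ℕ
  meets X u v = ind (lt u v ∧ adj H u v ∧ (lookup X u ∨ lookup X v))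

  ebar≡sum2 : ∀ X → ebar H X ≡ sum2 n (meets X)
  ebar≡sum2 X = sumF-cong n (λ u → count≡sumF n _)

  gained : Subset n → Subset n → Fin n → Fin n → ℕ
  gained X D u v = ind (lt u v ∧ adj H u v ∧ (lookup D u ∨ lookup D v) ∧ not (lookup X u ∨ lookup X v))

  ebar-∪ : ∀ X D → ebar H (X ∪ D) ≤ ebar H X + sum2 n (gained X D)
  ebar-∪ X D = begin
    ebar H (X ∪ D)                                 ≡⟨ ebar≡sum2 (X ∪ D) ⟩
    sum2 n (meets (X ∪ D))                         ≤⟨ sum2-mono n split ⟩
    sum2 n (λ u v → meets X u v + gained X D u v)  ≡⟨ sum2-+ n (meets X) (gained X D) ⟩
    sum2 n (meets X) + sum2 n (gained X D)         ≡⟨ cong (_+ sum2 n (gained X D)) (sym (ebar≡sum2 X)) ⟩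
    ebar H X + sum2 n (gained X D)                 ∎
    where
    open ≤-Reasoning
    split : ∀ u v → meets (X ∪ D) u v ≤ meets X u v + gained X D u v
    split u v rewrite lookup-∪ X D u | lookup-∪ X D v = ind-∪-split (lt u v) (adj H u v) (lookup X u) (lookup X v) (lookup D u) (lookup D v)

  irrefl : ∀ {v} → ¬ Adj H v v
  irrefl {v} loop with trans (sym loop) (adj-irrefl H v)
  ... | ()

  listed : ∀ {x d} → Adj H d x → (lt x d ≡ true × Adj H x d) ⊎ (lt d x ≡ true × Adj H d x)
  listed {x} {d} dx with <-cmp (toℕ x) (toℕ d)
  ... | tri< x<d _ _ = inj₁ (Equivalence.to T-≡ (<⇒<ᵇ x<d) , trans (adj-sym H x d) dx)
  ... | tri≈ _ x≡d _ = ⊥-elim (irrefl (subst (Adj H d) (toℕ-injective x≡d) dx))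
  ... | tri> _ _ d<x = inj₂ (Equivalence.to T-≡ (<⇒<ᵇ d<x) , dx)

  gained<ebar-at : ∀ X D p q → lt p q ≡ true → Adj H p q
    → (lookup X p ∨ lookup X q) ≡ true → (lookup D p ∨ lookup D q) ≡ true
    → sum2 n (gained X D) < ebar H D
  gained<ebar-at X D p q lpq apq Xpq Dpq =
    subst (sum2 n (gained X D) <_) (sym (ebar≡sum2 D))
      (sum2-mono-< n (λ u v → ind-gained≤ (lt u v) (adj H u v) _ _) p q
        (ind-gained<ind (lt p q) (adj H p q) (lookup D p ∨ lookup D q) (lookup X p ∨ lookup X q) lpq apq Dpq Xpq))

  gained<ebar : ∀ X D {x d} → x ∈ X → d ∈ D → Adj H d x → sum2 n (gained X D) < ebar H D
  gained<ebar X D {x} {d} x∈X d∈D dx with listed dx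
  ... | inj₁ (lxd , xd) = gained<ebar-at X D x d lxd xd (∨-introˡ _ (∈⇒lookup x∈X)) (∨-introʳ _ (∈⇒lookup d∈D))
  ... | inj₂ (ldx , dx') = gained<ebar-at X D d x ldx dx' (∨-introʳ _ (∈⇒lookup x∈X)) (∨-introˡ _ (∈⇒lookup d∈D))

  -- The edges gained by adjoining v join v to its neighbours outside X.
  gained-⁅⁆ : ∀ X v → sum2 n (gained X ⁅ v ⁆) ≤ degMinus H X v
  gained-⁅⁆ X v = begin
    sum2 n (gained X ⁅ v ⁆)
      ≤⟨ sum2-mono n (λ u u' → ind-gained-⁅⁆ (lt u u') (adj H u u') (δ u) (δ u') (lookup X u) (lookup X u')) ⟩
    sum2 n (λ u u' → ind (δ u ∧ out u u' u') + ind (δ u' ∧ out u u' u))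
      ≡⟨ sum2-+ n _ _ ⟩
    sum2 n (λ u u' → ind (δ u ∧ out u u' u')) + sum2 n (λ u u' → ind (δ u' ∧ out u u' u))
      ≡⟨ cong₂ _+_ (sum2-⁅⁆ v (λ u u' → out u u' u')) (sumF-cong n (λ u → sumF-⁅⁆ v (λ u' → out u u' u))) ⟩
    sumF n (λ u → ind (out v u u)) + sumF n (λ u → ind (out u v u))
      ≡⟨ sym (sumF-+ n _ _) ⟩
    sumF n (λ u → ind (out v u u) + ind (out u v u))
      ≤⟨ sumF-mono n both-orientations ⟩
    sumF n (λ u → ind (adj H v u ∧ not (lookup X u)))
      ≡⟨ sym (count≡sumF n _) ⟩
    degMinus H X v ∎
    where
    open ≤-Reasoning
    δ : Fin n → Bool
    δ u = lookup ⁅ v ⁆ u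
    out : Fin n → Fin n → Fin n → Bool
    out u u' y = lt u u' ∧ adj H u u' ∧ not (lookup X y)
    both-orientations : ∀ u → ind (out v u u) + ind (out u v u) ≤ ind (adj H v u ∧ not (lookup X u))
    both-orientations u rewrite adj-sym H u v =
      ind-exclusive (lt v u) (lt u v) _ (<ᵇ-exclusive (toℕ v) (toℕ u))

  ebar-∪-⁅⁆ : ∀ X v → ebar H (X ∪ ⁅ v ⁆) ≤ ebar H X + degMinus H X v
  ebar-∪-⁅⁆ X v = ≤-trans (ebar-∪ X ⁅ v ⁆) (+-monoʳ-≤ (ebar H X) (gained-⁅⁆ X v))

  -- Adjoining a set joined to X by an edge counts that edge only once.
  ebar-∪-joined : ∀ X D {x d} → x ∈ X → d ∈ D → Adj H d x → ebar H (X ∪ D) < ebar H X + ebar H D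
  ebar-∪-joined X D x∈X d∈D dx = ≤-<-trans (ebar-∪ X D) (+-monoʳ-< (ebar H X) (gained<ebar X D x∈X d∈D dx))

  ebar-∅ : ebar H ∅ ≡ 0
  ebar-∅ = trans (ebar≡sum2 ∅) (sumF-zero n (λ u → sumF-zero n (λ v → no-edge u v)))
    where
    no-edge : ∀ u v → meets ∅ u v ≡ 0
    no-edge u v rewrite lookup-∅ u | lookup-∅ v =
      cong ind (trans (cong (lt u v ∧_) (∧-zeroʳ (adj H u v))) (∧-zeroʳ (lt u v)))

  degMinus≤deg : ∀ X v → degMinus H X v ≤ deg H v
  degMinus≤deg X v = count-mono n (λ u → ∧-true-left (adj H v u))

  degMinus-antitone : ∀ {X Y} v → X ⊆ Y → degMinus H Y v ≤ degMinus H X v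
  degMinus-antitone {X} {Y} v X⊆Y = count-mono n (λ u →
    ∧-not-antitone (adj H v u) (lookup Y u) (lookup X u) (λ u∈X → ∈⇒lookup (X⊆Y (lookup⇒∈ u∈X))))

  ebar-⁅⁆ : ∀ v → ebar H ⁅ v ⁆ ≤ deg H v
  ebar-⁅⁆ v = begin
    ebar H ⁅ v ⁆               ≡⟨ cong (ebar H) (sym (∪-identityˡ ⁅ v ⁆)) ⟩
    ebar H (∅ ∪ ⁅ v ⁆)         ≤⟨ ebar-∪-⁅⁆ ∅ v ⟩
    ebar H ∅ + degMinus H ∅ v  ≡⟨ cong (_+ degMinus H ∅ v) ebar-∅ ⟩
    degMinus H ∅ v             ≤⟨ degMinus≤deg ∅ v ⟩
    deg H v                    ∎
    where open ≤-Reasoning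

  adjToSet-mono : ∀ {X Y v} → X ⊆ Y → AdjToSet H v X → AdjToSet H v Y
  adjToSet-mono X⊆Y (x , x∈X , vx) = x , X⊆Y x∈X , vx

  adjToSet? : ∀ X v → Dec (AdjToSet H v X)
  adjToSet? X v = any? (λ x → (x ∈? X) ×-dec (adj H v x ≟ᵇ true))

-- Saturation: if every set with P either has Q or can be replaced by a
-- strictly larger set with P, then P-sets grow into a set with P and Q,
-- since sizes are bounded by n.
saturate : ∀ {n} (P Q : Subset n → Set)
  → (∀ Z → P Z → Q Z ⊎ ∃[ Z' ] (P Z' × ∣ Z ∣ < ∣ Z' ∣))
  → ∀ Z → P Z → ∃[ Z' ] (P Z' × Q Z')
saturate {n} P Q step Z₀ pZ₀ = go n Z₀ (m≤m+n n ∣ Z₀ ∣) pZ₀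
  where
  -- fuel bounds the number of enlargements still possible
  go : ∀ fuel Z → n ≤ fuel + ∣ Z ∣ → P Z → ∃[ Z' ] (P Z' × Q Z')
  go fuel Z bound pZ with step Z pZ
  ... | inj₁ qZ = Z , pZ , qZ
  ... | inj₂ (Z' , pZ' , Z<Z') with fuel
  ...   | zero  = ⊥-elim (<⇒≱ Z<Z' (≤-trans (∣p∣≤n Z') bound))
  ...   | suc f = go f Z' (≤-trans bound (subst (_≤ f + ∣ Z' ∣) (+-suc f ∣ Z ∣) (+-monoʳ-≤ f Z<Z'))) pZ'

≤pred⇒< : ∀ {a k} → 1 ≤ k → a ≤ k ∸ 1 → a < k
≤pred⇒< {k = suc k} _ a≤k = s≤s a≤k

-- The growth argument, under the hypotheses of the corollary (with k ≥ 1,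
-- and without non-emptiness of clusters) for a set Y with (I)–(IV).
module ShadowGrowth (k : ℕ) (k≥1 : 1 ≤ k) {n m : ℕ} (H : Graph n) (C : Fin m → Subset n)
    (disjoint : ∀ i j → i ≢ j → Disjoint (C i) (C j))
    (ebarC : ∀ i → ebar H (C i) ≤ (k ∸ 1) * ∣ C i ∣ + 1)
    (degC : ∀ i v → v ∈ C i → k ≤ deg H v)
    (w : Fin n) (degw : deg H w ≤ k ∸ 1)
    (Y : Subset n) (propsY : ShadowProps k H C w Y) where

  open EdgeCounting H

  K : ℕ
  K = k ∸ 1

  Respects : Subset n → Set
  Respects Z = ∀ i → (C i ⊆ Z) ⊎ Disjoint (C i) Z

  record Approx (Z : Subset n) : Set where
    field
      within-Y : Z ⊆ Y
      has-w    : w ∈ Z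
      respects : Respects Z
      sparse   : ebar H Z ≤ K * ∣ Z ∣

  Larger : Subset n → Set
  Larger Z = ∃[ Z' ] (Approx Z' × ∣ Z ∣ < ∣ Z' ∣)

  respects-∪ : ∀ Z S → Respects Z → Respects S → Respects (Z ∪ S)
  respects-∪ Z S rZ rS i with rZ i | rS i
  ... | inj₁ Ci⊆Z | _          = inj₁ (λ x∈Ci → p⊆p∪q S (Ci⊆Z x∈Ci))
  ... | inj₂ _    | inj₁ Ci⊆S  = inj₁ (λ x∈Ci → q⊆p∪q Z S (Ci⊆S x∈Ci))
  ... | inj₂ Ci#Z | inj₂ Ci#S  = inj₂ (λ x x∈Ci x∈Z∪S → [ Ci#Z x x∈Ci , Ci#S x x∈Ci ] (x∈p∪q⁻ Z S x∈Z∪S))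

  cluster-respects : ∀ i → Respects (C i)
  cluster-respects i j with j ≟ i
  ... | yes refl = inj₁ id
  ... | no j≢i   = inj₂ (disjoint j i j≢i)

  ⁅⁆-respects : ∀ v → (∀ j → v ∉ C j) → Respects ⁅ v ⁆
  ⁅⁆-respects v v∉C j = inj₂ (λ x x∈Cj x∈v → v∉C j (subst (_∈ C j) (x∈⁅y⁆⇒x≡y v x∈v) x∈Cj))

  -- w has too small a degree to lie in a cluster.
  w∉C : ∀ j → w ∉ C j
  w∉C j w∈Cj = <⇒≱ (≤pred⇒< k≥1 degw) (degC j w w∈Cj)

  start : Approx ⁅ w ⁆
  start = record
    { within-Y = λ x∈w → subst (_∈ Y) (sym (x∈⁅y⁆⇒x≡y w x∈w)) (proj₁ propsY)
    ; has-w    = x∈⁅x⁆ w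
    ; respects = ⁅⁆-respects w w∉C
    ; sparse   = begin
        ebar H ⁅ w ⁆   ≤⟨ ebar-⁅⁆ w ⟩
        deg H w        ≤⟨ degw ⟩
        K              ≡⟨ sym (*-identityʳ K) ⟩
        K * 1          ≡⟨ cong (K *_) (sym (∣⁅x⁆∣≡1 w)) ⟩
        K * ∣ ⁅ w ⁆ ∣  ∎
    }
    where open ≤-Reasoning

  adjoinCluster : ∀ {Z} i {d} → Approx Z → d ∈ C i → AdjToSet H d Z → ¬ (C i ⊆ Z) → Larger Z
  adjoinCluster {Z} i {d} a d∈D (x , x∈Z , dx) D⊈Z = Z ∪ D , grown , ∣∪∣-grows Z D Z#D d∈D
    where
    open Approx a
    D : Subset n
    D = C i
    Z#D : Disjoint Z D
    Z#D y y∈Z y∈D with respects i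
    ... | inj₁ D⊆Z = D⊈Z D⊆Z
    ... | inj₂ D#Z = D#Z y y∈D y∈Z
    D⊆Y : D ⊆ Y
    D⊆Y = proj₂ (proj₂ (proj₂ propsY)) i (d , d∈D , x , within-Y x∈Z , dx)
    sparse-∪ : ebar H (Z ∪ D) ≤ K * ∣ Z ∪ D ∣
    sparse-∪ = ≤-pred (begin
      suc (ebar H (Z ∪ D))           ≤⟨ ebar-∪-joined Z D x∈Z d∈D dx ⟩
      ebar H Z + ebar H D            ≤⟨ +-mono-≤ sparse (ebarC i) ⟩
      K * ∣ Z ∣ + (K * ∣ D ∣ + 1)    ≡⟨ cong (K * ∣ Z ∣ +_) (+-comm (K * ∣ D ∣) 1) ⟩
      K * ∣ Z ∣ + suc (K * ∣ D ∣)    ≡⟨ +-suc (K * ∣ Z ∣) (K * ∣ D ∣) ⟩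
      suc (K * ∣ Z ∣ + K * ∣ D ∣)    ≡⟨ cong suc (*-∣∪∣ K Z D Z#D) ⟩
      suc (K * ∣ Z ∪ D ∣)            ∎)
      where open ≤-Reasoning
    grown : Approx (Z ∪ D)
    grown = record
      { within-Y = ∪-⊆ within-Y D⊆Y
      ; has-w    = p⊆p∪q D has-w
      ; respects = respects-∪ Z D respects (cluster-respects i)
      ; sparse   = sparse-∪
      }

  adjoinVertex : ∀ {Z} v → Approx Z → v ∉ Z → AdjToSet H v Z → degMinus H Z v < k
    → (∀ j → v ∉ C j) → Larger Z
  adjoinVertex {Z} v a v∉Z vZ low v∉C = Z ∪ ⁅ v ⁆ , grown , ∣∪∣-grows Z ⁅ v ⁆ Z#v (x∈⁅x⁆ v)
    where
    open Approx a
    Z#v : Disjoint Z ⁅ v ⁆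
    Z#v y y∈Z y∈v = v∉Z (subst (_∈ Z) (x∈⁅y⁆⇒x≡y v y∈v) y∈Z)
    -- outside Y, v would have at least k neighbours outside Y ⊇ Z
    v∈Y : v ∈ Y
    v∈Y = decidable-stable (v ∈? Y) (λ v∉Y → <⇒≱ low
      (≤-trans (proj₁ (proj₂ (proj₂ propsY)) v v∉Y (adjToSet-mono within-Y vZ)) (degMinus-antitone v within-Y)))
    sparse-∪ : ebar H (Z ∪ ⁅ v ⁆) ≤ K * ∣ Z ∪ ⁅ v ⁆ ∣
    sparse-∪ = begin
      ebar H (Z ∪ ⁅ v ⁆)           ≤⟨ ebar-∪-⁅⁆ Z v ⟩
      ebar H Z + degMinus H Z v    ≤⟨ +-mono-≤ sparse (∸-monoˡ-≤ 1 low) ⟩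
      K * ∣ Z ∣ + K                ≡⟨ cong (K * ∣ Z ∣ +_) (sym (trans (cong (K *_) (∣⁅x⁆∣≡1 v)) (*-identityʳ K))) ⟩
      K * ∣ Z ∣ + K * ∣ ⁅ v ⁆ ∣    ≡⟨ *-∣∪∣ K Z ⁅ v ⁆ Z#v ⟩
      K * ∣ Z ∪ ⁅ v ⁆ ∣            ∎
      where open ≤-Reasoning
    grown : Approx (Z ∪ ⁅ v ⁆)
    grown = record
      { within-Y = ∪-⊆ within-Y (λ y∈v → subst (_∈ Y) (sym (x∈⁅y⁆⇒x≡y v y∈v)) v∈Y)
      ; has-w    = p⊆p∪q ⁅ v ⁆ has-w
      ; respects = respects-∪ Z ⁅ v ⁆ respects (⁅⁆-respects v v∉C)
      ; sparse   = sparse-∪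
      }

  ClusterDefect : Subset n → Fin m → Set
  ClusterDefect Z i = (∃[ d ] (d ∈ C i × AdjToSet H d Z)) × ¬ (C i ⊆ Z)

  LowVertex : Subset n → Fin n → Set
  LowVertex Z v = v ∉ Z × AdjToSet H v Z × degMinus H Z v < k

  closed-IV : ∀ Z → ¬ ∃ (ClusterDefect Z) → ∀ i → ∃[ d ] (d ∈ C i × AdjToSet H d Z) → C i ⊆ Z
  closed-IV Z none i touches = decidable-stable (C i ⊆? Z) (λ Ci⊈Z → none (i , touches , Ci⊈Z))

  closed-III : ∀ Z → ¬ ∃ (LowVertex Z) → ∀ v → v ∉ Z → AdjToSet H v Z → k ≤ degMinus H Z v
  closed-III Z none v v∉Z vZ = decidable-stable (k ≤? degMinus H Z v) (λ k≰ → none (v , v∉Z , vZ , ≰⇒> k≰))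

  grow : ∀ Z → Approx Z → ShadowProps k H C w Z ⊎ Larger Z
  grow Z a with any? (λ i → any? (λ d → (d ∈? C i) ×-dec adjToSet? Z d) ×-dec ¬? (C i ⊆? Z))
  ... | yes (i , (d , d∈Ci , dZ) , Ci⊈Z) = inj₂ (adjoinCluster i a d∈Ci dZ Ci⊈Z)
  ... | no noCluster with any? (λ v → ¬? (v ∈? Z) ×-dec adjToSet? Z v ×-dec (degMinus H Z v <? k))
  ...   | yes (v , v∉Z , vZ , low) =
          inj₂ (adjoinVertex v a v∉Z vZ low (λ j v∈Cj → v∉Z (closed-IV Z noCluster j (v , v∈Cj , vZ) v∈Cj)))
  ...   | no noLow = inj₁ (Approx.has-w a , Approx.respects a , closed-III Z noLow , closed-IV Z noCluster)

corollary4p8 : (k : ℕ) → 2 ≤ k → {n m : ℕ} (H : Graph n) (C : Fin m → Subset n)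
    → (∀ i j → i ≢ j → Disjoint (C i) (C j))
    → (∀ i → Nonempty (C i))
    → (∀ i → ebar H (C i) ≤ (k ∸ 1) * ∣ C i ∣ + 1)
    → (∀ i v → v ∈ C i → k ≤ deg H v)
    → (w : Fin n) → deg H w ≤ k ∸ 1
    → (Y : Subset n) → IsShadow k H C w Y
    → ebar H Y ≤ (k ∸ 1) * ∣ Y ∣
corollary4p8 k k≥2 H C disjoint _ ebarC degC w degw Y (propsY , minimal) = Y-sparse
  where
  open ShadowGrowth k (≤-trans (s≤s z≤n) k≥2) H C disjoint ebarC degC w degw Y propsY
  -- grow {w} inside Y until (I)–(IV) hold; by minimality the result is Y
  Y-sparse : ebar H Y ≤ (k ∸ 1) * ∣ Y ∣
  Y-sparse with saturate Approx (ShadowProps k H C w) grow ⁅ w ⁆ start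
  ... | Z , approxZ , propsZ =
    subst (λ T → ebar H T ≤ K * ∣ T ∣) (⊆-antisym (Approx.within-Y approxZ) (minimal Z propsZ)) (Approx.sparse approxZ)
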